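{- Let a finite concurrent system with processes $P=\{1,\dots,n\}$, global state space $G$, local state spaces $L_p$, initial sets $\mathit{Init}_p$, transition relations $\stackrel{p}{\to}$ and error specification $(\langle p_1,E_1\rangle,\dots,\langle p_m,E_m\rangle)$ be given (as described in the context). If the system is safe, then there exists an invariant schema $A$ such that the Horn constraints (C1)–(C3) described in the context are semantically solvable, i.e. there exist set-theoretic relations $R_{\bar a}$ ($\bar a\in A$) making all of them true.
   Context: A system consists of: a non-empty set $G$ of global states; the process index set $P=\{1,\dots,n\}$; for each $p\in P$ a non-empty set $L_p$ of local states, a set $\mathit{Init}_p\subseteq G\times L_p$ of initial states, and a transition relation $(g,l)\stackrel{p}{\to}(g',l')$ on $G\times L_p$. The system state space is $S=G\times\prod_{p\in P}L_p$; for $s=(g,\bar l)$, $\bar l[p]\in L_p$ is the component of process $p$, and $\bar l[p/l']$ is $\bar l$ with component $p$ replaced by $l'$. Initial states: $S_0=\{(g,\bar l)\mid \forall p\in P.\ (g,\bar l[p])\in \mathit{Init}_p\}$. System transitions: $(g,\bar l)\to(g',\bar l[p/l'])$ whenever $p\in P$ and $(g,\bar l[p])\stackrel{p}{\to}(g',l')$. An error specification is a tuple $(\langle p_1,E_1\rangle,\dots,\langle p_m,E_m\rangle)$ with pairwise distinct $p_i\in P$ and $E_i\subseteq G\times L_{p_i}$; the error states are $\mathit{Err}=\{(g,\bar l)\in S\mid \forall i.\ (g,\bar l[p_i])\in E_i\}$. The system is safe if there is no finite sequence $s_0\to s_1\to\dots\to s_r$ with $s_0\in S_0$ and $s_r\in\mathit{Err}$.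 An invariant schema is an antichain $A\subseteq\{0,1\}^n$ with respect to the componentwise order on $\mathbb N^n$. For $\bar a=(a_1,\dots,a_n)\in A$ let $i_1<\dots<i_k$ be the indices with $a_i>0$, and for $\bar l\in\prod_p L_p$ write $\bar l[\bar a]=(\bar l[i_1],\dots,\bar l[i_k])$. For each $\bar a\in A$ there is an unknown relation $R_{\bar a}\subseteq G\times L_{i_1}\times\dots\times L_{i_k}$. For $Q\subseteq P$ define $\mathit{Ctxt}(Q,g,\bar l)=\bigwedge\{R_{\bar c}(g,\bar l[\bar c])\mid \bar c\in A,\ \exists q\in Q.\ \bar c[q]>0\}$, where $\bar c[q]$ is the $q$-th entry of $\bar c$. The Horn constraints are (all variables universally quantified): (C1) for each $\bar a\in A$ (with nonzero indices $i_1<\dots<i_k$): $R_{\bar a}(g,l_1,\dots,l_k)\leftarrow \mathit{Init}_{i_1}(g,l_1)\wedge\dots\wedge\mathit{Init}_{i_k}(g,l_k)$; (C2) for each $p\in\{1,\dots,n\}$ and $\bar a\in A$: $R_{\bar a}(g',\bar l[p/l'][\bar a])\leftarrow \big((g,\bar l[p])\stackrel{p}{\to}(g',l')\big)\wedge R_{\bar a}(g,\bar l[\bar a])\wedge \mathit{Ctxt}(\{p\},g,\bar l)$; (C3) $\mathit{false}\leftarrow \big(\bigwedge_{j=1}^m (g,\bar l[p_j])\in E_j\big)\wedge \mathit{Ctxt}(\{p_1,\dots,p_m\},g,\bar l)$. -}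

module Defs where

open import Data.Nat using (ℕ; suc)
open import Data.Fin using (Fin; _≟_)
open import Data.Bool using (Bool; true; false; T) renaming (_≤_ to _≤ᵇ_)
open import Data.Vec using (Vec; lookup)
open import Data.Product using (Σ; _×_; _,_)
open import Data.Empty using (⊥)
open import Relation.Nullary using (¬_; yes; no)
open import Relation.Binary.PropositionalEquality using (_≡_; refl)

record System (n : ℕ) : Set₁ where
  field
    G      : Set
    L      : Fin n → Set
    g₀     : G                                  -- G non-empty
    l₀     : (p : Fin n) → L p                  -- each L_p non-empty
    Init   : (p : Fin n) → G → L p → Set
    Trans  : (p : Fin n) → G → L p → G → L p → Set

module _ {n : ℕ} (Sys : System n) where
  open System Sys

  LVec : Set
  LVec = (p : Fin n) → L p

  upd : LVec → (p : Fin n) → L p → LVec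
  upd l p l' q with p ≟ q
  ... | yes refl = l'
  ... | no _     = l q

  InitState : G → LVec → Set
  InitState g l = (p : Fin n) → Init p g (l p)

  Step : G → LVec → G → LVec → Set
  Step g l g' l'' = Σ (Fin n) λ p → Σ (L p) λ l' →
    Trans p g (l p) g' l' × (l'' ≡ upd l p l')

  data Reachable : G → LVec → Set where
    init : ∀ {g l} → InitState g l → Reachable g l
    step : ∀ {g l g' l'} → Reachable g l → Step g l g' l' → Reachable g' l'

record ErrorSpec {n : ℕ} (Sys : System n) : Set₁ where
  open System Sys
  field
    m        : ℕ                       -- number of entries is suc m
    proc     : Fin (suc m) → Fin n
    distinct : ∀ i j → proc i ≡ proc j → i ≡ j
    E        : (j : Fin (suc m)) → G → L (proc j) → Set

module _ {n : ℕ} {Sys : System n} (Spec : ErrorSpec Sys) where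
  open System Sys
  open ErrorSpec Spec

  Err : G → LVec Sys → Set
  Err g l = (j : Fin (suc m)) → E j g (l (proc j))

  Safe : Set
  Safe = ∀ g l → Reachable Sys g l → ¬ Err g l

-- Invariant schemas: antichains A ⊆ {0,1}ⁿ (componentwise order),
-- given as a predicate on bit vectors (true = 1, false = 0).
Leq : {n : ℕ} → Vec Bool n → Vec Bool n → Set
Leq a b = ∀ q → lookup a q ≤ᵇ lookup b q

IsAntichain : {n : ℕ} → (Vec Bool n → Set) → Set
IsAntichain A = ∀ a b → A a → A b → Leq a b → a ≡ b

module _ {n : ℕ} (Sys : System n) where
  open System Sys

  -- tuples (l_{i₁},…,l_{i_k}) for the nonzero indices of ā
  Proj : Vec Bool n → Set
  Proj a = (q : Fin n) → T (lookup a q) → L q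

  restrict : (a : Vec Bool n) → LVec Sys → Proj a
  restrict a l q _ = l q

  Rels : Set₁
  Rels = (a : Vec Bool n) → G → Proj a → Set

  Ctxt : (Vec Bool n → Set) → Rels → (Fin n → Set) → G → LVec Sys → Set
  Ctxt A R Q g l = ∀ c → A c → (Σ (Fin n) λ q → Q q × (lookup c q ≡ true)) →
                   R c g (restrict c l)

  C1 : (Vec Bool n → Set) → Rels → Set
  C1 A R = ∀ a → A a → ∀ g (x : Proj a) →
           (∀ q (t : T (lookup a q)) → Init q g (x q t)) → R a g x

  C2 : (Vec Bool n → Set) → Rels → Set
  C2 A R = ∀ (p : Fin n) a → A a → ∀ g (l : LVec Sys) g' (l' : L p) →
           Trans p g (l p) g' l' → R a g (restrict a l) →
           Ctxt A R (λ q → q ≡ p) g l →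
           R a g' (restrict a (upd Sys l p l'))

  C3 : ErrorSpec Sys → (Vec Bool n → Set) → Rels → Set
  C3 Spec A R = ∀ g (l : LVec Sys) →
           (∀ j → E j g (l (proc j))) →
           Ctxt A R (λ q → Σ (Fin (suc m)) λ j → q ≡ proc j) g l → ⊥
    where open ErrorSpec Spec

  HornSolvable : ErrorSpec Sys → (Vec Bool n → Set) → Set₁
  HornSolvable Spec A = Σ Rels λ R → C1 A R × C2 A R × C3 Spec A R

module Submission where

-- A safe system always admits a solution of the Horn constraints for the
-- schema A = {1ⁿ}, whose single vector selects every process.  For that
-- schema a relation R_{1ⁿ}(g, l̄) sees the complete system state, so we may
-- take it to be the reachable-state set itself:
--   (C1) initial states are reachable;
--   (C2) a transition of any process from a reachable state is a system step,
--        hence leads to a reachable state;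
--   (C3) the context of the (non-empty) set of error processes contains the
--        conjunct R_{1ⁿ}(g, l̄), i.e. the state is reachable, and safety rules
--        out that it is an error state.

open import Defs
open import Data.Nat using (ℕ)
open import Data.Fin using (Fin; zero)
open import Data.Bool using (Bool; true)
open import Data.Bool.Properties using (T-≡)
open import Data.Vec using (Vec; lookup; replicate)
open import Data.Vec.Properties using (lookup-replicate)
open import Data.Product using (Σ; _×_; _,_; proj₂)
open import Function.Bundles using (Equivalence)
open import Relation.Binary.PropositionalEquality using (_≡_; refl; sym; trans; subst)

singleton-antichain : {n : ℕ} (c : Vec Bool n) → IsAntichain (_≡ c)
singleton-antichain c a b a≡c b≡c _ = trans a≡c (sym b≡c)

ones : (n : ℕ) → Vec Bool n
ones n = replicate n true

FullSchema : (n : ℕ) → Vec Bool n → Set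
FullSchema n = _≡ ones n

module _ {n : ℕ} (Sys : System n) where
  open System Sys

  ctxt-conjunct : ∀ {A R Q g l} (c : Vec Bool n) → A c →
                  (q : Fin n) → Q q → lookup c q ≡ true →
                  Ctxt Sys A R Q g l → R c g (restrict Sys c l)
  ctxt-conjunct c c∈A q q∈Q cq ctxt = ctxt c c∈A (q , q∈Q , cq)

  assemble : {a : Vec Bool n} → a ≡ ones n → Proj Sys a → LVec Sys
  assemble {a} a≡1 x q = x q (Equivalence.from T-≡ (selects q))
    where
    selects : (q : Fin n) → lookup a q ≡ true
    selects q = subst (λ b → lookup b q ≡ true) (sym a≡1) (lookup-replicate q true)

  Reach : Rels Sys
  Reach a g x = Σ (a ≡ ones n) λ a≡1 → Reachable Sys g (assemble a≡1 x)

  reach-C1 : C1 Sys (FullSchema n) Reach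
  reach-C1 a a≡1 g x initial = a≡1 , init (λ q → initial q _)

  reach-C2 : C2 Sys (FullSchema n) Reach
  reach-C2 p a _ g l g' l' tr (a≡1 , reachable) _ =
    a≡1 , step reachable (p , l' , tr , refl)

  reach-C3 : (Spec : ErrorSpec Sys) → Safe Spec → C3 Sys Spec (FullSchema n) Reach
  reach-C3 Spec safe g l err ctxt = safe g l reachable err
    where
    open ErrorSpec Spec
    reachable : Reachable Sys g l
    reachable = proj₂ (ctxt-conjunct {R = Reach} (ones n) refl (proc zero) (zero , refl)
                                     (lookup-replicate (proc zero) true) ctxt)

mainTheorem2 : (n : ℕ) (Sys : System n) (Spec : ErrorSpec Sys) →
    Safe Spec →
    Σ (Vec Bool n → Set) λ A → IsAntichain A × HornSolvable Sys Spec A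
mainTheorem2 n Sys Spec safe =
  FullSchema n , singleton-antichain (ones n) ,
  Reach Sys , reach-C1 Sys , reach-C2 Sys , reach-C3 Sys Spec safe
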